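{- $\mathbf{PAFKy^r}$ is more expressive than $\mathbf{ELKy^r}$ (over $\mathcal{S}5$ knowing-why models): every formula of $\mathcal{L}_{ELKy^r}$ is equivalent to a formula of $\mathcal{L}_{PAFKy^r}$, but some formula of $\mathcal{L}_{PAFKy^r}$ is not equivalent to any formula of $\mathcal{L}_{ELKy^r}$.
   Context: Fix a countable set of agents $\mathcal{A}$ and a countably infinite set of atoms $\mathcal{P}$. $\mathcal{L}_{ELKy^r}$: $\phi ::= p\mid\neg\phi\mid(\phi\land\phi)\mid K_a\phi\mid Ky_a^r(\phi,\phi)$; $\mathcal{L}_{PAFKy^r}$ extends it by $[\phi]\phi$. $\Lambda$ is a fixed set of valid formulas (tautology ground). An $\mathcal{S}5$ knowing-why model is $\mathfrak{M}=\langle W,E,\{R_a\}_{a\in\mathcal{A}},\mathcal{E},V\rangle$ with $W\neq\emptyset$; $E$ nonempty, containing a designated $e$, closed under a binary operation $\cdot$; each $R_a$ an equivalence relation on $W$; $\mathcal{E}:E\times\mathcal{L}_{PAFKy^r}\to 2^W$ with $\mathcal{E}(e,\phi)=W$ for $\phi\in\Lambda$ and $\mathcal{E}(s,\phi\to\psi)\cap\mathcal{E}(t,\phi)\subseteq\mathcal{E}(s\cdot t,\psi)$; $V:\mathcal{P}\to 2^W$. Truth: $p,\neg,\land$ as usual; $K_a\phi$ holds at $w$ iff $\phi$ holds at all $R_a$-successors; $Ky_a^r(\phi,\psi)$ holds at $w$ iff there is $t\in E$ such that every $v$ with $(w,v)\in R_a$ and $(\mathfrak{M},v)\models\phi$ satisfies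 $v\in\mathcal{E}(t,\psi)$ and $(\mathfrak{M},v)\models\psi$; $(\mathfrak{M},w)\models[\phi]\psi$ iff $(\mathfrak{M},w)\models\phi$ implies $(\mathfrak{M}|\phi,w)\models\psi$, where $\mathfrak{M}|\phi$ restricts $W$ to $W'=\{w\mid(\mathfrak{M},w)\models\phi\}$, $R_a$ to $R_a\cap(W'\times W')$, $V(p)$ to $V(p)\cap W'$ and $\mathcal{E}(t,\chi)$ to $\mathcal{E}(t,\chi)\cap W'$, keeping $E$. Two formulas are equivalent if they hold at exactly the same pointed models. $L_1$ is more expressive than $L_2$ if every $L_2$-formula is equivalent to some $L_1$-formula but not conversely. -}

module Defs where

open import Data.Nat using (ℕ)
open import Data.Bool using (Bool; true; false; not; _∧_)
open import Data.Product using (Σ; _×_; _,_; proj₁; proj₂)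
open import Data.Empty using (⊥)
open import Relation.Binary.PropositionalEquality using (_≡_)
open import Relation.Binary.Structures using (IsEquivalence)
open import Relation.Nullary using (¬_)
open import Function.Definitions using (Injective)

Atom : Set
Atom = ℕ

Countable : Set → Set
Countable A = Σ (A → ℕ) (λ f → Injective _≡_ _≡_ f)

data Form (Agent : Set) : Set where
  atom : Atom → Form Agent
  ¬'_  : Form Agent → Form Agent
  _∧'_ : Form Agent → Form Agent → Form Agent
  K    : Agent → Form Agent → Form Agent
  Ky   : Agent → Form Agent → Form Agent → Form Agent
  [_]_ : Form Agent → Form Agent → Form Agent

_⇒'_ : {Agent : Set} → Form Agent → Form Agent → Form Agent
φ ⇒' ψ = ¬' (φ ∧' (¬' ψ))

data FormEL (Agent : Set) : Set where
  atom : Atom → FormEL Agent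
  ¬'_  : FormEL Agent → FormEL Agent
  _∧'_ : FormEL Agent → FormEL Agent → FormEL Agent
  K    : Agent → FormEL Agent → FormEL Agent
  Ky   : Agent → FormEL Agent → FormEL Agent → FormEL Agent

ι : {Agent : Set} → FormEL Agent → Form Agent
ι (atom p) = atom p
ι (¬' φ) = ¬' ι φ
ι (φ ∧' ψ) = ι φ ∧' ι ψ
ι (K a φ) = K a (ι φ)
ι (Ky a φ ψ) = Ky a (ι φ) (ι ψ)

evalProp : {Agent : Set} → (Form Agent → Bool) → Form Agent → Bool
evalProp f (atom p) = f (atom p)
evalProp f (¬' φ) = not (evalProp f φ)
evalProp f (φ ∧' ψ) = evalProp f φ ∧ evalProp f ψ
evalProp f (K a φ) = f (K a φ)
evalProp f (Ky a φ ψ) = f (Ky a φ ψ)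
evalProp f ([ φ ] ψ) = f ([ φ ] ψ)

-- Λ : the tautology ground = instances of propositional tautologies.
Λ : {Agent : Set} → Form Agent → Set
Λ φ = ∀ f → evalProp f φ ≡ true

record Model (Agent : Set) : Set₁ where
  field
    W     : Set
    w₀    : W                       -- W ≠ ∅
    E     : Set
    e     : E                       -- designated element (so E ≠ ∅)
    _·_   : E → E → E
    R     : Agent → W → W → Set
    R-equiv : ∀ a → IsEquivalence (R a)
    ℰ     : E → Form Agent → W → Set
    ℰ-Λ   : ∀ φ → Λ φ → ∀ w → ℰ e φ w
    ℰ-app : ∀ s t φ ψ w → ℰ s (φ ⇒' ψ) w → ℰ t φ w → ℰ (s · t) ψ w
    V     : Atom → W → Set

open Model public

restrictEquiv : {W : Set} {P : W → Set} {R : W → W → Set} →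
  IsEquivalence R → IsEquivalence (λ (x y : Σ W P) → R (proj₁ x) (proj₁ y))
restrictEquiv eq = record
  { refl = IsEquivalence.refl eq
  ; sym = IsEquivalence.sym eq
  ; trans = IsEquivalence.trans eq }

mutual
  _,_⊨_ : {Agent : Set} → (M : Model Agent) → W M → Form Agent → Set
  M , w ⊨ atom p = V M p w
  M , w ⊨ (¬' φ) = ¬ (M , w ⊨ φ)
  M , w ⊨ (φ ∧' ψ) = (M , w ⊨ φ) × (M , w ⊨ ψ)
  M , w ⊨ K a φ = ∀ v → R M a w v → M , v ⊨ φ
  M , w ⊨ Ky a φ ψ =
    Σ (E M) (λ t → ∀ v → R M a w v → M , v ⊨ φ → ℰ M t ψ v × (M , v ⊨ ψ))
  M , w ⊨ ([ φ ] ψ) = (h : M , w ⊨ φ) → restrict M φ w h , w₀ (restrict M φ w h) ⊨ ψ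
  -- (w₀ (restrict M φ w h) is by definition the world (w , h) of 𝔐|φ)

  -- The updated model 𝔐|φ (given a φ-world, witnessing nonemptiness)
  restrict : {Agent : Set} → (M : Model Agent) → (φ : Form Agent) →
             (w : W M) → M , w ⊨ φ → Model Agent
  restrict M φ w h = record
    { W = Σ (W M) (λ v → M , v ⊨ φ)
    ; w₀ = w , h
    ; E = E M
    ; e = e M
    ; _·_ = _·_ M
    ; R = λ a x y → R M a (proj₁ x) (proj₁ y)
    ; R-equiv = λ a → restrictEquiv (R-equiv M a)
    ; ℰ = λ t χ x → ℰ M t χ (proj₁ x)
    ; ℰ-Λ = λ χ l x → ℰ-Λ M χ l (proj₁ x)
    ; ℰ-app = λ s t χ ψ x → ℰ-app M s t χ ψ (proj₁ x)
    ; V = λ p x → V M p (proj₁ x)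
    }

Equivalent : {Agent : Set} → Form Agent → Form Agent → Set₁
Equivalent {Agent} φ ψ =
  (M : Model Agent) (w : W M) → ((M , w ⊨ φ) → (M , w ⊨ ψ)) × ((M , w ⊨ ψ) → (M , w ⊨ φ))

MoreExpressive : (Agent : Set) → Set₁
MoreExpressive Agent =
  ((φ : FormEL Agent) → Σ (Form Agent) (λ ψ → Equivalent (ι φ) ψ))
  × Σ (Form Agent) (λ ψ → (φ : FormEL Agent) → ¬ Equivalent (ι φ) ψ)

module Submission where

-- The separating formula is  Ky a p ([p]p) : "a knows why p, with reason
-- [p]p".  We compare two one-world models, all atoms true and R total,
-- that differ only in their evidence function ℰ (every evidence term
-- supports the formulas of one "evidence predicate", closed under
-- tautologies and modus ponens):
--   * the full model, where every formula is evidenced;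
--   * the valuation model, where χ is evidenced iff it is true under the
--     boolean valuation 'pointValue', which makes every announcement false.
-- A truth lemma shows that in both models a static formula holds exactly
-- when 'pointValue' makes it true; the only evidence a static formula ever
-- asks for is evidence for a static formula that is already true.  Hence
-- no static formula distinguishes the two models, whereas Ky a p ([p]p)
-- holds in the first and fails in the second (its reason [p]p has no
-- evidence there).

open import Defs
open import Data.Bool using (Bool; true; false; not; _∧_; _∨_; T)
open import Data.Bool.Properties using (T-∧)
open import Data.Unit using (tt)
open import Data.Product using (Σ; _,_; proj₁; proj₂)
open import Data.Product.Function.NonDependent.Propositional using (_×-⇔_)
open import Function using (id)
open import Function.Bundles using (_⇔_; mk⇔; Equivalence)
open import Function.Construct.Composition using (_⇔-∘_)
open import Function.Construct.Symmetry using (⇔-sym)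
open import Level using (0ℓ)
open import Relation.Binary.Construct.Always using (Always; isEquivalence)
open import Relation.Binary.PropositionalEquality using (_≡_; refl; sym; cong; cong₂; subst)
open import Relation.Nullary using (¬_)
import Data.Unit as Unit

open Equivalence using (to; from)

not-⇔ : {X : Set} {b : Bool} → X ⇔ T b → (¬ X) ⇔ T (not b)
not-⇔ {b = true}  X⇔b = mk⇔ (λ ¬x → ¬x (from X⇔b tt)) (λ ())
not-⇔ {b = false} X⇔b = mk⇔ (λ _ → tt) (λ _ x → to X⇔b x)

T-implication : {b c : Bool} → (T b → T c) ⇔ T (not b ∨ c)
T-implication {true}  = mk⇔ (λ f → f tt) (λ c _ → c)
T-implication {false} = mk⇔ (λ _ → tt) (λ _ ())

-- Modus ponens for booleans, in the shape in which φ ⇒' ψ is evaluated.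
modusPonensᵇ : (b c : Bool) → T (not (b ∧ not c)) → T b → T c
modusPonensᵇ true true  _ _ = tt

module _ {A : Set} where

  -- A predicate on formulas satisfying the two constraints the definition
  -- of a model imposes on the evidence of the designated term e and on
  -- application: it contains Λ and is closed under modus ponens.
  record Evidence : Set₁ where
    field
      holds       : Form A → Set
      tautologies : ∀ φ → Λ φ → holds φ
      modusPonens : ∀ φ ψ → holds (φ ⇒' ψ) → holds φ → holds ψ

  open Evidence

  pointModel : Evidence → Model A
  pointModel ev = record
    { W = Unit.⊤ ; w₀ = tt ; E = Unit.⊤ ; e = tt ; _·_ = λ _ _ → tt
    ; R = λ _ → Always ; R-equiv = λ _ → isEquivalence Unit.⊤ 0ℓ
    ; ℰ = λ _ χ _ → holds ev χ
    ; ℰ-Λ = λ φ l _ → tautologies ev φ l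
    ; ℰ-app = λ _ _ φ ψ _ → modusPonens ev φ ψ
    ; V = λ _ _ → Unit.⊤ }

  fullEvidence : Evidence
  fullEvidence = record
    { holds = λ _ → Unit.⊤
    ; tautologies = λ _ _ → tt
    ; modusPonens = λ _ _ _ _ → tt }

  valuationEvidence : (Form A → Bool) → Evidence
  valuationEvidence f = record
    { holds = λ χ → T (evalProp f χ)
    ; tautologies = λ φ l → subst T (sym (l f)) tt
    ; modusPonens = λ φ ψ → modusPonensᵇ (evalProp f φ) (evalProp f ψ) }

  -- The truth value of a formula at the point of a point model: atoms are
  -- true, K is transparent (R is total and reflexive), Ky a φ ψ behaves as
  -- the implication φ → ψ, and announcements are declared false.  The last
  -- clause is arbitrary for truth; it only matters for evidence.
  pointValue : Form A → Bool
  pointValue (atom p)   = true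
  pointValue (¬' φ)     = not (pointValue φ)
  pointValue (φ ∧' ψ)   = pointValue φ ∧ pointValue ψ
  pointValue (K a φ)    = pointValue φ
  pointValue (Ky a φ ψ) = not (pointValue φ) ∨ pointValue ψ
  pointValue ([ φ ] ψ)  = false

  evalProp-pointValue : ∀ φ → evalProp pointValue φ ≡ pointValue φ
  evalProp-pointValue (atom p)   = refl
  evalProp-pointValue (¬' φ)     = cong not (evalProp-pointValue φ)
  evalProp-pointValue (φ ∧' ψ)   = cong₂ _∧_ (evalProp-pointValue φ) (evalProp-pointValue ψ)
  evalProp-pointValue (K a φ)    = refl
  evalProp-pointValue (Ky a φ ψ) = refl
  evalProp-pointValue ([ φ ] ψ)  = refl

  -- Evidence given by pointValue itself: a formula is evidenced iff its
  -- point value is true; in particular [p]p is not evidenced.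
  pointEvidence : Evidence
  pointEvidence = valuationEvidence pointValue

  module TruthAtPoint (ev : Evidence)
                      (trueIsEvidenced : ∀ χ → T (pointValue χ) → holds ev χ) where

    truthAtPoint : (φ : FormEL A) → (pointModel ev , tt ⊨ ι φ) ⇔ T (pointValue (ι φ))
    truthAtPoint (atom p)   = mk⇔ (λ _ → tt) (λ _ → tt)
    truthAtPoint (¬' φ)     = not-⇔ (truthAtPoint φ)
    truthAtPoint (φ ∧' ψ)   = ⇔-sym T-∧ ⇔-∘ (truthAtPoint φ ×-⇔ truthAtPoint ψ)
    truthAtPoint (K a φ)    =
      mk⇔ (λ □φ → to (truthAtPoint φ) (□φ tt _)) (λ φ-true _ _ → from (truthAtPoint φ) φ-true)
    truthAtPoint (Ky a φ ψ) = mk⇔ knowsWhy⇒implication implication⇒knowsWhy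
      where
        knowsWhy⇒implication : pointModel ev , tt ⊨ Ky a (ι φ) (ι ψ) →
                               T (pointValue (ι (Ky a φ ψ)))
        knowsWhy⇒implication (_ , reasons) = to T-implication λ φ-true →
          to (truthAtPoint ψ) (proj₂ (reasons tt _ (from (truthAtPoint φ) φ-true)))

        -- Any term serves as the reason: its evidence for ψ is supplied by
        -- trueIsEvidenced, since ψ is true whenever it is required.
        implication⇒knowsWhy : T (pointValue (ι (Ky a φ ψ))) →
                               pointModel ev , tt ⊨ Ky a (ι φ) (ι ψ)
        implication⇒knowsWhy φ→ψ = tt , λ _ _ φ-holds →
          let ψ-true = from T-implication φ→ψ (to (truthAtPoint φ) φ-holds)
          in trueIsEvidenced (ι ψ) ψ-true , from (truthAtPoint ψ) ψ-true

  open TruthAtPoint using (truthAtPoint)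

  pointTrue-fullEvidence : ∀ χ → T (pointValue χ) → holds fullEvidence χ
  pointTrue-fullEvidence _ _ = tt

  pointTrue-pointEvidence : ∀ χ → T (pointValue χ) → holds pointEvidence χ
  pointTrue-pointEvidence χ = subst T (sym (evalProp-pointValue χ))

  staticTransfer : (φ : FormEL A) →
                   pointModel fullEvidence , tt ⊨ ι φ → pointModel pointEvidence , tt ⊨ ι φ
  staticTransfer φ holdsInFull =
    from (truthAtPoint pointEvidence pointTrue-pointEvidence φ)
      (to (truthAtPoint fullEvidence pointTrue-fullEvidence φ) holdsInFull)

  announcedReason : A → Form A
  announcedReason a = Ky a (atom 0) ([ atom 0 ] atom 0)

  announcedReason-full : (a : A) → pointModel fullEvidence , tt ⊨ announcedReason a
  announcedReason-full a = tt , λ _ _ _ → tt , λ _ → tt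

  -- In the valuation model [p]p has no evidence, so no reason exists.
  announcedReason-point : (a : A) → ¬ (pointModel pointEvidence , tt ⊨ announcedReason a)
  announcedReason-point a (_ , reasons) = proj₁ (reasons tt _ tt)

corollary4p6 : (Agent : Set) → Countable Agent → Agent → MoreExpressive Agent
corollary4p6 Agent _ a = embedding , announcedReason a , inexpressible
  where
    embedding : (φ : FormEL Agent) → Σ (Form Agent) (λ ψ → Equivalent (ι φ) ψ)
    embedding φ = ι φ , λ _ _ → id , id

    inexpressible : (φ : FormEL Agent) → ¬ Equivalent (ι φ) (announcedReason a)
    inexpressible φ φ≡announced =
      announcedReason-point a (proj₁ (φ≡announced (pointModel pointEvidence) tt)
        (staticTransfer φ (proj₂ (φ≡announced (pointModel fullEvidence) tt) (announcedReason-full a))))
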